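{- Let $q$ be a power of an odd prime $p$, let $n=p^ku$ with $\gcd(u,p)=1$, and let $m$ be a divisor of $n$ with $m<n$. Let $f\in\mathbb{F}_q[x]$ be a monic divisor of $x^u-1$ not divisible by $x-1$, and assume that if $f\neq 1$ then $m=1$ or $m$ is a power of $p$. Let $\beta\in\mathbb{F}_{q^m}$. Let $q'$ be the square-free part (product of the distinct prime divisors) of $q^n-1$. For a divisor $l$ of $q'$ let $N(f,m,\beta)_l$ be the number of $w\in\mathbb{F}_{q^n}^*$ such that $w$ is $l$-free, $w^2$ is $f$-free over $\mathbb{F}_q$ and $\mathrm{Tr}_{q^n/q^m}(w^2)=\beta$, and let $N_2(n)_l$ be the number of $w\in\mathbb{F}_{q^n}^*$ such that $w$ is $l$-free and $w^2$ is normal over $\mathbb{F}_q$. Let $r_1,\dots,r_s$ be divisors of $q'$ and $q_0$ a positive integer such that $\gcd(r_i,r_j)=q_0$ for all $i\neq j$ and $\mathrm{lcm}(r_1,\dots,r_s)=q'$. Then \[N(f,m,\beta)_{q'}\geq \sum_{i=1}^s N(f,m,\beta)_{r_i}-(s-1)N(f,m,\beta)_{q_0}\] and \[N_2(n)_{q'}\geq \sum_{i=1}^s N_2(n)_{r_i}-(s-1)N_2(n)_{q_0}.\]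
   Context: For a divisor $l$ of $q^n-1$, an element $w\in\mathbb{F}_{q^n}^*$ is $l$-free if $w=y^d$ with $y\in\mathbb{F}_{q^n}$ and $d$ a divisor of $l$ implies $d=1$. For $g(x)=\sum a_ix^i\in\mathbb{F}_q[x]$ and $\gamma\in\mathbb{F}_{q^n}$ write $g\circ\gamma=\sum a_i\gamma^{q^i}$. For a monic divisor $f$ of $x^n-1$, an element $v\in\mathbb{F}_{q^n}$ is $f$-free over $\mathbb{F}_q$ if $v=h\circ\gamma$ with $\gamma\in\mathbb{F}_{q^n}$ and $h$ a monic divisor of $f$ implies $h=1$. Normal over $\mathbb{F}_q$ means $v,v^q,\dots,v^{q^{n-1}}$ form an $\mathbb{F}_q$-basis of $\mathbb{F}_{q^n}$. $\mathrm{Tr}_{q^n/q^m}(x)=\sum_{i=0}^{n/m-1}x^{q^{mi}}$. -}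

module Defs where

open import Data.Nat as ℕ using (ℕ; zero; suc)
open import Data.Fin using (Fin; toℕ)
import Data.Fin as F
open import Data.List using (List; []; _∷_; map; replicate; _++_; foldr)
open import Data.List.Relation.Unary.All using (All)
open import Data.List.Relation.Unary.Unique.Propositional using (Unique)
open import Data.List.Membership.Propositional using (_∈_)
open import Data.Nat.Divisibility using (_∣_)
open import Data.Nat.Primality using (Prime)
open import Data.Nat.LCM using (lcm)
open import Data.Product using (Σ; _×_; ∃)
open import Data.Unit using (⊤)
open import Relation.Binary.PropositionalEquality using (_≡_; _≢_)
open import Algebra.Structures using (IsCommutativeRing)

HasSize : {A : Set} → (A → Set) → ℕ → Set
HasSize {A} P N =
  Σ (Fin N → A) λ e →
    (∀ i j → e i ≡ e j → i ≡ j) ×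
    (∀ i → P (e i)) ×
    (∀ x → P x → Σ (Fin N) λ i → e i ≡ x)

record FiniteField (N : ℕ) : Set₁ where
  infixl 6 _+_
  infixl 7 _*_
  field
    Carrier    : Set
    _+_ _*_    : Carrier → Carrier → Carrier
    -_         : Carrier → Carrier
    0# 1#      : Carrier
    isCommutativeRing : IsCommutativeRing _≡_ _+_ _*_ -_ 0# 1#
    0≢1        : 0# ≢ 1#
    inverse    : ∀ x → x ≢ 0# → Σ Carrier λ y → x * y ≡ 1#
    size       : HasSize {Carrier} (λ _ → ⊤) N

  _^_ : Carrier → ℕ → Carrier
  x ^ zero  = 1#
  x ^ suc k = x * (x ^ k)

  sumFin : (d : ℕ) → (Fin d → Carrier) → Carrier
  sumFin zero    f = 0#
  sumFin (suc d) f = f F.zero + sumFin d (λ i → f (F.suc i))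

-- Everything below is relative to a finite field K of order q^n,
-- with F_q realised as its (unique) subfield {x | x^q = x}.

module Setup (q n : ℕ) (K : FiniteField (q ℕ.^ n)) where
  open FiniteField K

  -- membership in the subfield F_{q^j} of K
  InF : ℕ → Carrier → Set
  InF j x = x ^ (q ℕ.^ j) ≡ x

  InFq : Carrier → Set
  InFq = InF 1

  -- polynomials: coefficient lists (constant term first)
  Poly : Set
  Poly = List Carrier

  OverFq : Poly → Set
  OverFq = All InFq

  addP : Poly → Poly → Poly
  addP []       g        = g
  addP (a ∷ f)  []       = a ∷ f
  addP (a ∷ f)  (b ∷ g)  = (a + b) ∷ addP f g

  mulP : Poly → Poly → Poly
  mulP []      g = []
  mulP (a ∷ f) g = addP (map (a *_) g) (0# ∷ mulP f g)

  -- monic: last coefficient is 1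
  data Monic : Poly → Set where
    monic-one  : Monic (1# ∷ [])
    monic-cons : ∀ {a f} → Monic f → Monic (a ∷ f)

  one : Poly
  one = 1# ∷ []

  xpow-1 : ℕ → Poly
  xpow-1 k = addP (replicate k 0# ++ (1# ∷ [])) ((- 1#) ∷ [])

  x-1 : Poly
  x-1 = (- 1#) ∷ 1# ∷ []

  DividesFq : Poly → Poly → Set
  DividesFq f g = Σ Poly λ h → OverFq h × mulP f h ≡ g

  -- g ∘ γ = Σ a_i γ^{q^i}
  compAt : ℕ → Poly → Carrier → Carrier
  compAt i []      γ = 0#
  compAt i (a ∷ g) γ = a * (γ ^ (q ℕ.^ i)) + compAt (suc i) g γ

  _∘ₚ_ : Poly → Carrier → Carrier
  g ∘ₚ γ = compAt 0 g γ

  Free : ℕ → Carrier → Set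
  Free l w = w ≢ 0# × (∀ (y : Carrier) (d : ℕ) → d ∣ l → w ≡ y ^ d → d ≡ 1)

  PolyFree : Poly → Carrier → Set
  PolyFree f v = ∀ (γ : Carrier) (h : Poly) → OverFq h → Monic h →
                 DividesFq h f → v ≡ h ∘ₚ γ → h ≡ one

  Normal : Carrier → Set
  Normal v =
    (∀ (c : Fin n → Carrier) → (∀ i → InFq (c i)) →
       sumFin n (λ i → c i * (v ^ (q ℕ.^ toℕ i))) ≡ 0# → ∀ i → c i ≡ 0#) ×
    (∀ (x : Carrier) → Σ (Fin n → Carrier) λ c → (∀ i → InFq (c i)) ×
       x ≡ sumFin n (λ i → c i * (v ^ (q ℕ.^ toℕ i))))

  -- Tr_{q^n/q^m}(x) = Σ_{i < d} x^{q^{m i}}, where d = n/m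
  Tr : (m d : ℕ) → Carrier → Carrier
  Tr m d x = sumFin d (λ i → x ^ (q ℕ.^ (m ℕ.* toℕ i)))

IsRadicalOf : ℕ → ℕ → Set
IsRadicalOf x r = Σ (List ℕ) λ ps →
  Unique ps × All Prime ps × All (_∣ x) ps ×
  (∀ p → Prime p → p ∣ x → p ∈ ps) ×
  foldr ℕ._*_ 1 ps ≡ r

lcmFin : (s : ℕ) → (Fin s → ℕ) → ℕ
lcmFin zero    r = 1
lcmFin (suc s) r = lcm (r F.zero) (lcmFin s (λ i → r (F.suc i)))

open import Data.Integer as ℤ using (ℤ)

sumℤ : (s : ℕ) → (Fin s → ℤ) → ℤ
sumℤ zero    f = ℤ.+ 0
sumℤ (suc s) f = f F.zero ℤ.+ sumℤ s (λ i → f (F.suc i))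

module Submission where

-- Proposition 5 is a sieve inequality: the freeness condition "w is l-free"
-- only weakens as l shrinks, and w is lcm(r₁,…,r_s)-free exactly when it is
-- rᵢ-free for every i.  Writing Aᵢ for the set counted by N(rᵢ), A for the one
-- counted by N(q₀) and Q for the one counted by N(q′), we therefore have
-- Aᵢ ⊆ A (as q₀ ∣ rᵢ) and A₁ ∩ … ∩ A_s ⊆ Q, and the Bonferroni-type bound
--   |A₁| + … + |A_s| ≤ (s − 1)|A| + |Q|
-- holds pointwise for indicator functions, hence after summing over the field.
-- The extra condition on w² (f-free with prescribed trace, or normal) is carried
-- along unchanged, so the argument is done once for an arbitrary property P.
-- The file develops, in order: sums of natural numbers and indicators; sizes
-- of subsets of finite types as sums of indicators; the Bonferroni bound;
-- freeness under divisors and lcm's; the sieve inequality for any P (over ℕ and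
-- then over ℤ); and the fact that rad(qⁿ − 1) ≠ 1 for odd q, which excludes the
-- degenerate family s = 0.  Proposition 5 is the sieve applied to both counts.

open import Defs
open import Data.Nat using (ℕ; _^_; _*_; _∸_; _<_; _≤_)
open import Data.Nat.Divisibility using (_∣_)
open import Data.Nat.Primality using (Prime)
open import Data.Nat.GCD using (gcd)
open import Data.Nat.Coprimality using (Coprime)
open import Data.Fin using (Fin)
open import Data.Integer as ℤ using (ℤ; +_)
open import Data.Product using (Σ; _×_)
open import Data.Sum using (_⊎_)
open import Relation.Nullary using (¬_)
open import Relation.Binary.PropositionalEquality using (_≡_; _≢_)

open import Data.Nat using (zero; suc; _+_; z≤n; s≤s; _%_; _/_)
open import Data.Nat.Properties
  using (≤-refl; ≤-trans; ≤-reflexive; ≤-antisym; +-mono-≤; m≤m+n; *-suc; *-zeroʳ;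
         *-identityʳ; +-identityʳ; +-comm; m≤n+m∸n; +-*-semiring; m+n∸m≡n)
  renaming (_≟_ to _≟ℕ_; module ≤-Reasoning to ℕ-Reasoning)
open import Data.Nat.Divisibility
  using (divides; ∣-refl; ∣-trans; ∣1⇒≡1; m∣m*n; n∣m*n; m%n≡0⇒n∣m)
open import Data.Nat.DivMod using (m≡m%n+[m/n]*n; m%n<n; %-distribˡ-*)
open import Data.Nat.Primality using (prime[2]; prime⇒irreducible)
open import Data.Nat.GCD using (gcd[m,n]∣m; gcd[m,n]∣n)
open import Data.Nat.LCM using (lcm; lcm-least)
open import Data.Nat.Coprimality using (coprime-divisor; gcd≡1⇒coprime)
open import Data.Fin using (punchIn) renaming (zero to fzero; suc to fsuc; _≟_ to _≟ꟳ_)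
open import Data.Fin.Properties using (injective⇒≤; any?; all?; ¬∀⟶∃¬)
  renaming (suc-injective to fsuc-injective)
import Data.Integer.Properties as ℤP
open import Data.Nat.ListAction.Properties using (∈⇒∣product)
open import Data.Product using (_,_; proj₁; proj₂)
open import Data.Sum using (inj₁; inj₂)
open import Data.Empty using (⊥-elim)
open import Data.Unit using (⊤; tt)
open import Function using (_∘_)
open import Relation.Nullary using (Dec; yes; no)
open import Relation.Nullary.Decidable using (map′)
open import Relation.Unary using (Decidable)
open import Relation.Binary.Definitions using (DecidableEquality)
open import Relation.Binary.PropositionalEquality
  using (refl; sym; trans; cong; cong₂; subst; module ≡-Reasoning)
open import Algebra.Structures using (IsCommutativeRing)
open import Algebra.Properties.Semiring.Sum +-*-semiring
  using (sum; ∑-comm; ∑-distrib-+; *-distribˡ-sum; sum-cong-≗;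
         sum-remove; sum-replicate-zero)

⟦_⟧ : {A : Set} → Dec A → ℕ
⟦ yes _ ⟧ = 1
⟦ no _ ⟧  = 0

⟦⟧≤1 : {A : Set} (a : Dec A) → ⟦ a ⟧ ≤ 1
⟦⟧≤1 (yes _) = s≤s z≤n
⟦⟧≤1 (no _)  = z≤n

⟦⟧-true : {A : Set} (a : Dec A) → A → ⟦ a ⟧ ≡ 1
⟦⟧-true (yes _) _ = refl
⟦⟧-true (no ¬x) x = ⊥-elim (¬x x)

⟦⟧-false : {A : Set} (a : Dec A) → ¬ A → ⟦ a ⟧ ≤ 0
⟦⟧-false (yes x) ¬x = ⊥-elim (¬x x)
⟦⟧-false (no _)  _  = z≤n

∑-mono-≤ : ∀ {n} {f g : Fin n → ℕ} → (∀ i → f i ≤ g i) → sum f ≤ sum g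
∑-mono-≤ {zero}  f≤g = ≤-refl
∑-mono-≤ {suc n} f≤g = +-mono-≤ (f≤g fzero) (∑-mono-≤ (f≤g ∘ fsuc))

∑-≤-card : ∀ {n} (f : Fin n → ℕ) → (∀ i → f i ≤ 1) → sum f ≤ n
∑-≤-card {zero}  f f≤1 = z≤n
∑-≤-card {suc n} f f≤1 = +-mono-≤ (f≤1 fzero) (∑-≤-card (f ∘ fsuc) (f≤1 ∘ fsuc))

∑-≤-card-miss : ∀ {n} (f : Fin n → ℕ) → (∀ i → f i ≤ 1) → (i₀ : Fin n) → f i₀ ≤ 0 →
  sum f ≤ n ∸ 1
∑-≤-card-miss {suc n} f f≤1 i₀ fi₀≤0 = begin
  sum f                         ≡⟨ sum-remove {i = i₀} f ⟩
  f i₀ + sum (f ∘ punchIn i₀)   ≤⟨ +-mono-≤ fi₀≤0 (∑-≤-card _ (f≤1 ∘ punchIn i₀)) ⟩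
  n                             ∎
  where open ℕ-Reasoning

indicator-bound : ∀ {s} {A Q : Set} {Aᵢ : Fin s → Set}
  (a : Dec A) (aᵢ : ∀ i → Dec (Aᵢ i)) (q : Dec Q) →
  (∀ i → Aᵢ i → A) → ((∀ i → Aᵢ i) → Q) →
  sum (λ i → ⟦ aᵢ i ⟧) ≤ (s ∸ 1) * ⟦ a ⟧ + ⟦ q ⟧
indicator-bound {s} (no ¬A) aᵢ q Aᵢ⇒A all⇒Q = begin
  sum (λ i → ⟦ aᵢ i ⟧)   ≤⟨ ∑-mono-≤ (λ i → ⟦⟧-false (aᵢ i) (¬A ∘ Aᵢ⇒A i)) ⟩
  sum {s} (λ _ → 0)      ≡⟨ sum-replicate-zero s ⟩
  0                      ≤⟨ z≤n ⟩
  (s ∸ 1) * 0 + ⟦ q ⟧    ∎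
  where open ℕ-Reasoning
indicator-bound {s} (yes _) aᵢ q Aᵢ⇒A all⇒Q with all? aᵢ
... | yes all = begin
  sum (λ i → ⟦ aᵢ i ⟧)   ≤⟨ ∑-≤-card _ (⟦⟧≤1 ∘ aᵢ) ⟩
  s                      ≤⟨ m≤n+m∸n s 1 ⟩
  1 + (s ∸ 1)            ≡⟨ +-comm 1 (s ∸ 1) ⟩
  s ∸ 1 + 1              ≡⟨ cong₂ _+_ (sym (*-identityʳ (s ∸ 1))) (sym (⟦⟧-true q (all⇒Q all))) ⟩
  (s ∸ 1) * 1 + ⟦ q ⟧    ∎
  where open ℕ-Reasoning
... | no ¬all with ¬∀⟶∃¬ s _ aᵢ ¬all
...   | i₀ , ¬Aᵢ₀ = begin
  sum (λ i → ⟦ aᵢ i ⟧)   ≤⟨ ∑-≤-card-miss _ (⟦⟧≤1 ∘ aᵢ) i₀ (⟦⟧-false (aᵢ i₀) ¬Aᵢ₀) ⟩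
  s ∸ 1                  ≡⟨ sym (*-identityʳ (s ∸ 1)) ⟩
  (s ∸ 1) * 1            ≤⟨ m≤m+n _ _ ⟩
  (s ∸ 1) * 1 + ⟦ q ⟧    ∎
  where open ℕ-Reasoning

-- Sizes of subsets.  An injection between the enumerations of X ⊆ Y bounds
-- |X| ≤ |Y|; in particular the size of a subset is unique.
size-mono : {A : Set} {X Y : A → Set} {a b : ℕ} →
  (∀ x → X x → Y x) → HasSize X a → HasSize Y b → a ≤ b
size-mono X⊆Y (e , e-inj , e∈X , _) (e′ , _ , _ , e′-onto) =
  injective⇒≤ {f = proj₁ ∘ pos} λ {i} {j} eq →
    e-inj i j (trans (sym (proj₂ (pos i))) (trans (cong e′ eq) (proj₂ (pos j))))
  where
  pos : ∀ i → Σ (Fin _) λ k → e′ k ≡ e i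
  pos i = e′-onto (e i) (X⊆Y _ (e∈X i))

size-unique : {A : Set} {X : A → Set} {a b : ℕ} → HasSize X a → HasSize X b → a ≡ b
size-unique Ha Hb = ≤-antisym (size-mono (λ _ x → x) Ha Hb) (size-mono (λ _ x → x) Hb Ha)

enumerate : ∀ {M} {P : Fin M → Set} (P? : Decidable P) → HasSize P (sum (λ k → ⟦ P? k ⟧))
enumerate {zero}      P? = (λ ()) , (λ ()) , (λ ()) , (λ ())
enumerate {suc M} {P} P? = extend (P? fzero) (enumerate (P? ∘ fsuc))
  where
  extend : ∀ {c} (p₀ : Dec (P fzero)) → HasSize (P ∘ fsuc) c → HasSize P (⟦ p₀ ⟧ + c)
  extend (yes p₀) (e , e-inj , e∈P , e-onto) = e⁺ , e⁺-inj , e⁺∈P , e⁺-onto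
    where
    e⁺ : Fin _ → Fin (suc M)
    e⁺ fzero    = fzero
    e⁺ (fsuc a) = fsuc (e a)
    e⁺-inj : ∀ a b → e⁺ a ≡ e⁺ b → a ≡ b
    e⁺-inj fzero    fzero    _  = refl
    e⁺-inj fzero    (fsuc _) ()
    e⁺-inj (fsuc _) fzero    ()
    e⁺-inj (fsuc a) (fsuc b) eq = cong fsuc (e-inj a b (fsuc-injective eq))
    e⁺∈P : ∀ a → P (e⁺ a)
    e⁺∈P fzero    = p₀
    e⁺∈P (fsuc a) = e∈P a
    e⁺-onto : ∀ k → P k → Σ (Fin _) λ a → e⁺ a ≡ k
    e⁺-onto fzero    _  = fzero , refl
    e⁺-onto (fsuc k) pk = fsuc (proj₁ (e-onto k pk)) , cong fsuc (proj₂ (e-onto k pk))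
  extend (no ¬p₀) (e , e-inj , e∈P , e-onto) =
    fsuc ∘ e , (λ a b eq → e-inj a b (fsuc-injective eq)) , e∈P , e⁺-onto
    where
    e⁺-onto : ∀ k → P k → Σ (Fin _) λ a → fsuc (e a) ≡ k
    e⁺-onto fzero    pk = ⊥-elim (¬p₀ pk)
    e⁺-onto (fsuc k) pk = proj₁ (e-onto k pk) , cong fsuc (proj₂ (e-onto k pk))

module FiniteType {T : Set} {M : ℕ} (T-size : HasSize {T} (λ _ → ⊤) M) where

  elem : Fin M → T
  elem = proj₁ T-size

  index : T → Fin M
  index x = proj₁ (proj₂ (proj₂ (proj₂ T-size)) x tt)

  elem-index : ∀ x → elem (index x) ≡ x
  elem-index x = proj₂ (proj₂ (proj₂ (proj₂ T-size)) x tt)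

  index-elem : ∀ k → index (elem k) ≡ k
  index-elem k = proj₁ (proj₂ T-size) _ _ (elem-index (elem k))

  index-injective : ∀ {x y} → index x ≡ index y → x ≡ y
  index-injective {x} {y} eq = trans (sym (elem-index x)) (trans (cong elem eq) (elem-index y))

  -- A finite type has decidable equality, so every subset of finite size is
  -- decidable: x ∈ X iff x occurs in the enumeration of X.
  _≟_ : DecidableEquality T
  x ≟ y = map′ index-injective (cong index) (index x ≟ꟳ index y)

  decide : ∀ {X : T → Set} {n} → HasSize X n → Decidable X
  decide {X} (e , _ , e∈X , e-onto) x =
    map′ (λ (j , ej≡x) → subst X ej≡x (e∈X j)) (e-onto x) (any? (λ j → e j ≟ x))

  restrict : ∀ {X : T → Set} {n} → HasSize X n → HasSize (X ∘ elem) n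
  restrict {X} (e , e-inj , e∈X , e-onto) =
    index ∘ e ,
    (λ i j eq → e-inj i j (index-injective eq)) ,
    (λ j → subst X (sym (elem-index (e j))) (e∈X j)) ,
    (λ k x → proj₁ (e-onto (elem k) x) , trans (cong index (proj₂ (e-onto (elem k) x))) (index-elem k))

  size-as-sum : ∀ {X : T → Set} {n} (HX : HasSize X n) → n ≡ sum (λ k → ⟦ decide HX (elem k) ⟧)
  size-as-sum HX = size-unique (restrict HX) (enumerate (decide HX ∘ elem))

  bonferroni : ∀ {s} {A Q : T → Set} {Aᵢ : Fin s → T → Set} {nA nQ : ℕ} {nᵢ : Fin s → ℕ} →
    HasSize A nA → (∀ i → HasSize (Aᵢ i) (nᵢ i)) → HasSize Q nQ →
    (∀ i x → Aᵢ i x → A x) → (∀ x → (∀ i → Aᵢ i x) → Q x) →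
    sum nᵢ ≤ (s ∸ 1) * nA + nQ
  bonferroni {s} {nA = nA} {nQ} {nᵢ} HA HAᵢ HQ Aᵢ⊆A ⋂Aᵢ⊆Q = begin
    sum nᵢ                                   ≡⟨ sum-cong-≗ (size-as-sum ∘ HAᵢ) ⟩
    sum (λ i → sum (λ k → [Aᵢ] i k))         ≡⟨ ∑-comm [Aᵢ] ⟩
    sum (λ k → sum (λ i → [Aᵢ] i k))         ≤⟨ ∑-mono-≤ pointwise ⟩
    sum (λ k → (s ∸ 1) * [A] k + [Q] k)      ≡⟨ ∑-distrib-+ _ [Q] ⟩
    sum (λ k → (s ∸ 1) * [A] k) + sum [Q]    ≡⟨ cong (_+ sum [Q]) (sym (*-distribˡ-sum (s ∸ 1) [A])) ⟩
    (s ∸ 1) * sum [A] + sum [Q]              ≡⟨ cong₂ (λ a b → (s ∸ 1) * a + b) (sym (size-as-sum HA)) (sym (size-as-sum HQ)) ⟩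
    (s ∸ 1) * nA + nQ                        ∎
    where
    open ℕ-Reasoning
    [Aᵢ] : Fin s → Fin M → ℕ
    [Aᵢ] i k = ⟦ decide (HAᵢ i) (elem k) ⟧
    [A] [Q] : Fin M → ℕ
    [A] k = ⟦ decide HA (elem k) ⟧
    [Q] k = ⟦ decide HQ (elem k) ⟧
    pointwise : ∀ k → sum (λ i → [Aᵢ] i k) ≤ (s ∸ 1) * [A] k + [Q] k
    pointwise k = indicator-bound (decide HA (elem k)) (λ i → decide (HAᵢ i) (elem k)) (decide HQ (elem k))
      (λ i → Aᵢ⊆A i (elem k)) (⋂Aᵢ⊆Q (elem k))

module Freeness (q n : ℕ) (K : FiniteField (q ^ n)) where
  open FiniteField K using (Carrier; 0#; 1#; isCommutativeRing) renaming (_^_ to _^ᴷ_; _*_ to _*ᴷ_)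
  open IsCommutativeRing isCommutativeRing using (*-assoc; *-identityˡ)
  open Setup q n K using (Free)

  ^-+ : ∀ x a b → x ^ᴷ (a + b) ≡ (x ^ᴷ a) *ᴷ (x ^ᴷ b)
  ^-+ x zero    b = sym (*-identityˡ _)
  ^-+ x (suc a) b = trans (cong (x *ᴷ_) (^-+ x a b)) (sym (*-assoc _ _ _))

  ^-* : ∀ x a b → x ^ᴷ (a * b) ≡ (x ^ᴷ a) ^ᴷ b
  ^-* x a zero    = cong (x ^ᴷ_) (*-zeroʳ a)
  ^-* x a (suc b) = begin
    x ^ᴷ (a * suc b)            ≡⟨ cong (x ^ᴷ_) (*-suc a b) ⟩
    x ^ᴷ (a + a * b)            ≡⟨ ^-+ x a (a * b) ⟩
    x ^ᴷ a *ᴷ x ^ᴷ (a * b)      ≡⟨ cong (x ^ᴷ a *ᴷ_) (^-* x a b) ⟩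
    x ^ᴷ a *ᴷ (x ^ᴷ a) ^ᴷ b     ∎
    where open ≡-Reasoning

  free-divisor : ∀ {l l′ w} → l′ ∣ l → Free l w → Free l′ w
  free-divisor l′∣l (w≢0 , free) = w≢0 , λ y d d∣l′ → free y d (∣-trans d∣l′ l′∣l)

  free-1 : ∀ {w} → w ≢ 0# → Free 1 w
  free-1 w≢0 = w≢0 , λ _ _ d∣1 _ → ∣1⇒≡1 d∣1

  -- An a-free and b-free element is lcm(a,b)-free: if w = yᵈ with d ∣ lcm(a,b),
  -- then g = gcd(d,a) satisfies w = (y^(d/g))ᵍ, so g = 1 by a-freeness; hence
  -- d is coprime to a, divides b, and d = 1 by b-freeness.
  free-lcm : ∀ {a b w} → Free a w → Free b w → Free (lcm a b) w
  free-lcm {a} {b} {w} (w≢0 , free-a) (_ , free-b) =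
    w≢0 , λ y d d∣lcm w≡yᵈ → coprime-case y d d∣lcm w≡yᵈ (gcd d a ≟ℕ 1)
    where
    coprime-case : ∀ y d → d ∣ lcm a b → w ≡ y ^ᴷ d → Dec (gcd d a ≡ 1) → d ≡ 1
    coprime-case y d d∣lcm w≡yᵈ (yes g≡1) =
      free-b y d (coprime-divisor (gcd≡1⇒coprime g≡1) (∣-trans d∣lcm (lcm-least (m∣m*n {a} b) (n∣m*n a)))) w≡yᵈ
    coprime-case y d d∣lcm w≡yᵈ (no g≢1) with gcd[m,n]∣m d a
    ... | divides c d≡c*g = ⊥-elim (g≢1 (free-a (y ^ᴷ c) (gcd d a) (gcd[m,n]∣n d a)
            (trans w≡yᵈ (trans (cong (y ^ᴷ_) d≡c*g) (^-* y c (gcd d a))))))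

  free-lcmFin : ∀ {s} {r : Fin s → ℕ} {w} → w ≢ 0# → (∀ i → Free (r i) w) → Free (lcmFin s r) w
  free-lcmFin {zero}  w≢0 free = free-1 w≢0
  free-lcmFin {suc s} w≢0 free = free-lcm (free fzero) (free-lcmFin w≢0 (free ∘ fsuc))

sumℤ-+ : ∀ s (f : Fin s → ℕ) → sumℤ s (λ i → + f i) ≡ + sum f
sumℤ-+ zero    f = refl
sumℤ-+ (suc s) f = trans (cong (ℤ._+_ (+ f fzero)) (sumℤ-+ s (f ∘ fsuc))) (sym (ℤP.pos-+ (f fzero) _))

bound-ℕ⇒ℤ : ∀ s (f : Fin (suc s) → ℕ) X Y → sum f ≤ s * X + Y →
  sumℤ (suc s) (λ i → + f i) ℤ.- (+ suc s ℤ.- + 1) ℤ.* + X ℤ.≤ + Y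
bound-ℕ⇒ℤ s f X Y bound = begin
  sumℤ (suc s) (λ i → + f i) ℤ.- + s ℤ.* + X   ≡⟨ cong₂ ℤ._-_ (sumℤ-+ (suc s) f) (sym (ℤP.pos-* s X)) ⟩
  + sum f ℤ.- + (s * X)                        ≡⟨ ℤP.[+m]-[+n]≡m⊖n (sum f) (s * X) ⟩
  sum f ℤ.⊖ s * X                              ≤⟨ ℤP.⊖-monoˡ-≤ (s * X) bound ⟩
  (s * X + Y) ℤ.⊖ s * X                        ≡⟨ ℤP.⊖-≥ (m≤m+n (s * X) Y) ⟩
  + (s * X + Y ∸ s * X)                        ≡⟨ cong +_ (m+n∸m≡n (s * X) Y) ⟩
  + Y                                          ∎
  where open ℤP.≤-Reasoning

module Sieve (q n : ℕ) (K : FiniteField (q ^ n)) (P : FiniteField.Carrier K → Set)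
  (N : ℕ → ℕ) (q′ : ℕ)
  (count : ∀ l → l ∣ q′ → HasSize (λ w → Setup.Free q n K l w × P w) (N l)) where
  open FiniteField K using (size)
  open Setup q n K using (Free)
  open Freeness q n K using (free-divisor; free-lcmFin)
  open FiniteType size using (bonferroni)

  ⋂⊆Q : ∀ {s} (r : Fin (suc s) → ℕ) → lcmFin (suc s) r ≡ q′ →
    ∀ w → (∀ i → Free (r i) w × P w) → Free q′ w × P w
  ⋂⊆Q r lcm≡q′ w all =
    subst (λ l → Free l w) lcm≡q′ (free-lcmFin (proj₁ (proj₁ (all fzero))) (proj₁ ∘ all)) ,
    proj₂ (all fzero)

  sieve-ℕ : (s : ℕ) (r : Fin (suc s) → ℕ) (q₀ : ℕ) → (∀ i → r i ∣ q′) →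
    (∀ i j → ¬ i ≡ j → gcd (r i) (r j) ≡ q₀) → lcmFin (suc s) r ≡ q′ →
    sum (λ i → N (r i)) ≤ s * N q₀ + N q′
  -- a single r₁: the set counted by N r₁ lies inside the one counted by N q′
  sieve-ℕ zero r q₀ rᵢ∣q′ _ lcm≡q′ = ≤-trans (≤-reflexive (+-identityʳ _))
    (size-mono (λ w x → ⋂⊆Q r lcm≡q′ w (λ { fzero → x ; (fsuc ()) }))
      (count (r fzero) (rᵢ∣q′ fzero)) (count q′ ∣-refl))
  -- at least two rᵢ: q₀ = gcd(rᵢ, rⱼ) divides every rᵢ, so Bonferroni applies
  sieve-ℕ (suc s) r q₀ rᵢ∣q′ gcd≡q₀ lcm≡q′ =
    bonferroni (count q₀ (∣-trans (q₀∣ fzero) (rᵢ∣q′ fzero))) (λ i → count (r i) (rᵢ∣q′ i)) (count q′ ∣-refl)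
      (λ i w (free , pw) → free-divisor (q₀∣ i) free , pw) (⋂⊆Q r lcm≡q′)
    where
    q₀∣ : ∀ i → q₀ ∣ r i
    q₀∣ fzero    = subst (_∣ r fzero) (gcd≡q₀ fzero (fsuc fzero) (λ ())) (gcd[m,n]∣m _ _)
    q₀∣ (fsuc i) = subst (_∣ r (fsuc i)) (gcd≡q₀ (fsuc i) fzero (λ ())) (gcd[m,n]∣m _ _)

  -- The integer form; an empty family is excluded since its lcm is 1 ≠ q′.
  sieve : q′ ≢ 1 → (s : ℕ) (r : Fin s → ℕ) (q₀ : ℕ) → (∀ i → r i ∣ q′) →
    (∀ i j → ¬ i ≡ j → gcd (r i) (r j) ≡ q₀) → lcmFin s r ≡ q′ →
    sumℤ s (λ i → + N (r i)) ℤ.- (+ s ℤ.- + 1) ℤ.* + N q₀ ℤ.≤ + N q′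
  sieve q′≢1 zero    r q₀ _ _ lcm≡q′ = ⊥-elim (q′≢1 (sym lcm≡q′))
  sieve q′≢1 (suc s) r q₀ rᵢ∣q′ gcd≡q₀ lcm≡q′ =
    bound-ℕ⇒ℤ s (N ∘ r) (N q₀) (N q′) (sieve-ℕ s r q₀ rᵢ∣q′ gcd≡q₀ lcm≡q′)

-- For an odd prime power q, qⁿ − 1 is even, so its radical is not 1.
odd-prime : ∀ {p} → Prime p → p ≢ 2 → p % 2 ≡ 1
odd-prime {p} p-prime p≢2 with p % 2 in p%2≡ | m%n<n p 2
... | 1           | _ = refl
... | 0           | _ with prime⇒irreducible p-prime (m%n≡0⇒n∣m p 2 p%2≡)
...   | inj₁ ()
...   | inj₂ 2≡p = ⊥-elim (p≢2 (sym 2≡p))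
odd-prime p-prime p≢2 | suc (suc _) | s≤s (s≤s ())

^-odd : ∀ x k → x % 2 ≡ 1 → x ^ k % 2 ≡ 1
^-odd x zero    _       = refl
^-odd x (suc k) x%2≡1 =
  trans (%-distribˡ-* x (x ^ k) 2) (cong₂ (λ a b → (a * b) % 2) x%2≡1 (^-odd x k x%2≡1))

odd⇒2∣pred : ∀ x → x % 2 ≡ 1 → 2 ∣ x ∸ 1
odd⇒2∣pred x x%2≡1 = divides (x / 2) (cong (_∸ 1) (trans (m≡m%n+[m/n]*n x 2) (cong (_+ (x / 2) * 2) x%2≡1)))

prime∣radical : ∀ {p x r} → Prime p → p ∣ x → IsRadicalOf x r → p ∣ r
prime∣radical p-prime p∣x (ps , _ , _ , _ , complete , product≡r) =
  subst (_ ∣_) product≡r (∈⇒∣product (complete _ p-prime p∣x))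

radical-pred-odd≢1 : ∀ {x r} → x % 2 ≡ 1 → IsRadicalOf (x ∸ 1) r → r ≢ 1
radical-pred-odd≢1 {x} x%2≡1 rad refl with ∣1⇒≡1 (prime∣radical prime[2] (odd⇒2∣pred x x%2≡1) rad)
... | ()

-- Only the oddness of q enters (through q′ ≠ 1); the conditions on f, m and β
-- merely describe the property of w² that the sieve carries along.
proposition5 :
  (p e q k u n m : ℕ) → Prime p → p ≢ 2 → 1 ≤ e → q ≡ p ^ e →
  Coprime u p → n ≡ p ^ k * u → (m∣n : m ∣ n) → m < n →
  (K : FiniteField (q ^ n)) →
  let open FiniteField K using (Carrier) renaming (_^_ to _^ᴷ_)
      open Setup q n K in
  (f : Poly) → OverFq f → Monic f → DividesFq f (xpow-1 u) → ¬ DividesFq x-1 f →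
  (¬ f ≡ one → m ≡ 1 ⊎ Σ ℕ (λ j → m ≡ p ^ j)) →
  (β : Carrier) → InF m β →
  (q′ : ℕ) → IsRadicalOf (q ^ n ∸ 1) q′ →
  (N : ℕ → ℕ) →
  (∀ l → l ∣ q′ →
     HasSize (λ w → Free l w × PolyFree f (w ^ᴷ 2) × Tr m (_∣_.quotient m∣n) (w ^ᴷ 2) ≡ β) (N l)) →
  (N₂ : ℕ → ℕ) →
  (∀ l → l ∣ q′ → HasSize (λ w → Free l w × Normal (w ^ᴷ 2)) (N₂ l)) →
  (s : ℕ) (r : Fin s → ℕ) (q₀ : ℕ) →
  (∀ i → r i ∣ q′) → 1 ≤ q₀ →
  (∀ i j → ¬ i ≡ j → gcd (r i) (r j) ≡ q₀) →
  lcmFin s r ≡ q′ →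
  (sumℤ s (λ i → + N (r i)) ℤ.- (+ s ℤ.- + 1) ℤ.* + N q₀ ℤ.≤ + N q′) ×
  (sumℤ s (λ i → + N₂ (r i)) ℤ.- (+ s ℤ.- + 1) ℤ.* + N₂ q₀ ℤ.≤ + N₂ q′)
proposition5 p e q _ _ n _ p-prime p≢2 _ q≡pᵉ _ _ _ _ K _ _ _ _ _ _ _ _
             q′ radical N count N₂ count₂ s r q₀ rᵢ∣q′ _ gcd≡q₀ lcm≡q′ =
  Sieve.sieve q n K _ N q′ count q′≢1 s r q₀ rᵢ∣q′ gcd≡q₀ lcm≡q′ ,
  Sieve.sieve q n K _ N₂ q′ count₂ q′≢1 s r q₀ rᵢ∣q′ gcd≡q₀ lcm≡q′
  where
  q-odd : q % 2 ≡ 1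
  q-odd = subst (λ x → x % 2 ≡ 1) (sym q≡pᵉ) (^-odd p e (odd-prime p-prime p≢2))
  q′≢1 : q′ ≢ 1
  q′≢1 = radical-pred-odd≢1 {q ^ n} (^-odd q n q-odd) radical
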